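{- Let $S$ be a numerical semigroup that is neither ordinary nor almost-ordinary. Then $\operatorname{e}(\mathcal{B}(S))\ge\operatorname{e}(S)$.
   Context: $\mathbb{N}=\{0,1,2,\ldots\}$. A numerical semigroup is a submonoid $S$ of $(\mathbb{N},+)$ with $\mathbb{N}\setminus S$ finite; $\operatorname{e}(S)$ is the number of minimal generators of $S$ (elements of $S\setminus\{0\}$ not expressible as a sum of two elements of $S\setminus\{0\}$). $\operatorname{H}(S)=\mathbb{N}\setminus S$; $\operatorname{F}(S)=\max\operatorname{H}(S)$; $\operatorname{m}(S)=\min(S\setminus\{0\})$. $S$ is ordinary if $S=\{0\}\cup\{x\in\mathbb{N}\mid x\ge c\}$ for some $c$; $S$ is almost-ordinary if $S=\{0\}\cup\{g,\ldots,g+n-2\}\cup\{x\in\mathbb{N}\mid x\ge g+n\}$ for some integers $g>2$, $n\in[2,g]$. For non ordinary $S$, the sub-Frobenius number is $\operatorname{u}(S)=\max(\operatorname{H}(S)\setminus\{\operatorname{F}(S)\})$. For $S$ neither ordinary nor almost-ordinary, $\mathcal{B}(S)=(S\cup\{\operatorname{u}(S)\})\setminus\{\operatorname{m}(S)\}$, which is a numerical semigroup. -}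

module Defs where

open import Level using (0ℓ)
open import Data.Nat using (ℕ; _+_; _∸_; _≤_; _<_)
open import Data.Product using (Σ; ∃; ∃-syntax; _×_)
open import Data.Sum using (_⊎_)
open import Data.List using (List; length)
open import Data.List.Relation.Unary.Unique.Propositional using (Unique)
import Data.List.Membership.Propositional as LM
open import Function.Bundles using (_⇔_)
open import Relation.Nullary using (¬_; Dec)
open import Relation.Binary.PropositionalEquality using (_≡_; _≢_)

record NumericalSemigroup : Set₁ where
  field
    Mem      : ℕ → Set
    mem?     : (x : ℕ) → Dec (Mem x)
    zero-mem : Mem 0
    +-closed : ∀ {x y} → Mem x → Mem y → Mem (x + y)
    cofinite : ∃[ c ] (∀ x → c ≤ x → Mem x)
open NumericalSemigroup public

Ordinary : NumericalSemigroup → Set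
Ordinary S = ∃[ c ] (∀ x → Mem S x ⇔ (x ≡ 0 ⊎ c ≤ x))

AlmostOrdinary : NumericalSemigroup → Set
AlmostOrdinary S =
  ∃[ g ] ∃[ n ] (2 < g × 2 ≤ n × n ≤ g ×
    (∀ x → Mem S x ⇔ (x ≡ 0 ⊎ (g ≤ x × x ≤ g + n ∸ 2) ⊎ g + n ≤ x)))

IsFrobenius : NumericalSemigroup → ℕ → Set
IsFrobenius S f = ¬ Mem S f × (∀ x → ¬ Mem S x → x ≤ f)

IsSubFrobenius : NumericalSemigroup → ℕ → ℕ → Set
IsSubFrobenius S f u =
  ¬ Mem S u × u ≢ f × (∀ x → ¬ Mem S x → x ≢ f → x ≤ u)

IsMultiplicity : NumericalSemigroup → ℕ → Set
IsMultiplicity S m = Mem S m × 0 < m × (∀ x → Mem S x → 0 < x → m ≤ x)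

MinimalGenerator : NumericalSemigroup → ℕ → Set
MinimalGenerator S x =
  Mem S x × 0 < x ×
  ¬ (∃[ a ] ∃[ b ] (Mem S a × Mem S b × 0 < a × 0 < b × a + b ≡ x))

EmbeddingDimension : NumericalSemigroup → ℕ → Set
EmbeddingDimension S k =
  Σ (List ℕ) λ L → Unique L × (∀ x → (x LM.∈ L) ⇔ MinimalGenerator S x) × length L ≡ k

{-# OPTIONS --safe #-}
-- Under the hypotheses the sub-Frobenius number u exceeds the
-- multiplicity m: otherwise every gap but F(S) lies below m, which makes S
-- ordinary or almost-ordinary (or, when m = 2, makes u + u = m lie in B(S)).
-- With m < u, every nonzero element of B(S) exceeds m, and the map sending
-- m ↦ u, F(S) + m ↦ 2m and fixing every other minimal generator of S is an
-- injection from the minimal generators of S into those of B(S).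
module Submission where

open import Defs
open import Data.Nat using (ℕ; zero; suc; _+_; _∸_; _≤_; _<_; s≤s; s≤s⁻¹; z<s; _≟_; _≤?_)
open import Data.Nat.Properties
open import Algebra.Properties.CommutativeSemigroup +-commutativeSemigroup using (x∙yz≈y∙xz)
open import Data.Fin using (Fin; zero; suc)
open import Data.Fin.Properties using (injective⇒≤)
open import Data.Product using (_×_; _,_; proj₁; proj₂; ∃-syntax)
open import Data.Sum using (_⊎_; inj₁; inj₂; [_,_])
open import Data.List using (List; length; lookup)
open import Data.List.Relation.Unary.All as All using ()
open import Data.List.Relation.Unary.AllPairs using (_∷_)
open import Data.List.Relation.Unary.Any as Any using ()
open import Data.List.Relation.Unary.Unique.Propositional using (Unique)
open import Data.List.Membership.Propositional using (_∈_)
open import Data.List.Membership.Propositional.Properties using (∈-lookup)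
open import Data.List.Membership.Setoid.Properties using (index-injective)
open import Function using (_∘_)
open import Function.Bundles using (_⇔_; mk⇔; Equivalence)
open import Relation.Binary using (tri<; tri≈; tri>)
open import Relation.Nullary using (¬_; yes; no; contradiction)
open import Relation.Nullary.Decidable using (dec-no)
open import Relation.Binary.PropositionalEquality
  using (_≡_; _≢_; refl; sym; trans; cong; subst; setoid; module ≡-Reasoning)

lookup-injective : ∀ {A : Set} {xs : List A} → Unique xs →
                   ∀ {i j} → lookup xs i ≡ lookup xs j → i ≡ j
lookup-injective (_ ∷ _)         {zero}  {zero}  _ = refl
lookup-injective (x∉xs ∷ _)      {zero}  {suc j} e = contradiction e (All.lookup x∉xs (∈-lookup j))
lookup-injective (x∉xs ∷ _)      {suc i} {zero}  e = contradiction (sym e) (All.lookup x∉xs (∈-lookup i))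
lookup-injective (_ ∷ xs-unique) {suc i} {suc j} e = cong suc (lookup-injective xs-unique e)

length-≤-by-injection : ∀ {A B : Set} {xs : List A} {ys : List B} (φ : A → B) → Unique xs →
                        (∀ {x y} → x ∈ xs → y ∈ xs → φ x ≡ φ y → x ≡ y) →
                        (∀ {x} → x ∈ xs → φ x ∈ ys) →
                        length xs ≤ length ys
length-≤-by-injection {B = B} {xs} φ xs-unique φ-injective φ-into =
  injective⇒≤ {f = position} λ {i} {j} →
    lookup-injective xs-unique ∘ φ-injective (∈-lookup i) (∈-lookup j) ∘
      index-injective (setoid B) (φ-into (∈-lookup i)) (φ-into (∈-lookup j))
  where
  position : Fin (length xs) → Fin _
  position i = Any.index (φ-into (∈-lookup {xs = xs} i))

Decomposable : NumericalSemigroup → ℕ → Set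
Decomposable S x = ∃[ a ] ∃[ b ] (Mem S a × Mem S b × 0 < a × 0 < b × a + b ≡ x)

module _ (S : NumericalSemigroup) where

  ∉⇒positive : ∀ {x} → ¬ Mem S x → 0 < x
  ∉⇒positive {zero}  0∉S = contradiction (zero-mem S) 0∉S
  ∉⇒positive {suc x} _   = z<s

  module _ {m : ℕ} (mult : IsMultiplicity S m) where

    ∈⇒≡0⊎multiplicity≤ : ∀ {x} → Mem S x → x ≡ 0 ⊎ m ≤ x
    ∈⇒≡0⊎multiplicity≤ {zero}  _   = inj₁ refl
    ∈⇒≡0⊎multiplicity≤ {suc x} x∈S = inj₂ (proj₂ (proj₂ mult) (suc x) x∈S (z<s))

  module _ {f : ℕ} (frob : IsFrobenius S f) where

    >Frobenius⇒∈ : ∀ {x} → f < x → Mem S x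
    >Frobenius⇒∈ {x} f<x with mem? S x
    ... | yes x∈S = x∈S
    ... | no  x∉S = contradiction (proj₂ frob x x∉S) (<⇒≱ f<x)

    module _ {u : ℕ} (sub : IsSubFrobenius S f u) where

      sub<gap⇒≡Frobenius : ∀ {x} → ¬ Mem S x → u < x → x ≡ f
      sub<gap⇒≡Frobenius {x} x∉S u<x with x ≟ f
      ... | yes x≡f = x≡f
      ... | no  x≢f = contradiction (proj₂ (proj₂ sub) x x∉S x≢f) (<⇒≱ u<x)

    module _ {m : ℕ} (mult : IsMultiplicity S m) where

      Frobenius<multiplicity⇒Ordinary : f < m → Ordinary S
      Frobenius<multiplicity⇒Ordinary f<m = m , λ x → mk⇔ (∈⇒≡0⊎multiplicity≤ mult) λ where
        (inj₁ refl) → zero-mem S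
        (inj₂ m≤x)  → >Frobenius⇒∈ (<-≤-trans f<m m≤x)

      module _ {u : ℕ} (sub : IsSubFrobenius S f u) where

        Frobenius∸multiplicity≤sub : m ≤ f → f ∸ m ≤ u
        Frobenius∸multiplicity≤sub m≤f = proj₂ (proj₂ sub) (f ∸ m) f∸m∉S (<⇒≢ (∸-monoʳ-< 0<m m≤f))
          where
          0<m : 0 < m
          0<m = proj₁ (proj₂ mult)
          f∸m∉S : ¬ Mem S (f ∸ m)
          f∸m∉S f∸m∈S = proj₁ frob (subst (Mem S) (m+[n∸m]≡n m≤f) (+-closed S (proj₁ mult) f∸m∈S))

        module _ (u<m : u < m) where

          sub<multiplicity⇒Frobenius<2m : f < m + m
          sub<multiplicity⇒Frobenius<2m with m ≤? f
          ... | yes m≤f = subst (_< m + m) (m+[n∸m]≡n m≤f)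
                            (+-monoʳ-< m (≤-<-trans (Frobenius∸multiplicity≤sub m≤f) u<m))
          ... | no  m≰f = <-≤-trans (≰⇒> m≰f) (m≤m+n m m)

          sub<multiplicity⇒∈ : ∀ {x} → m ≤ x → x ≢ f → Mem S x
          sub<multiplicity⇒∈ {x} m≤x x≢f with mem? S x
          ... | yes x∈S = x∈S
          ... | no  x∉S = contradiction (proj₂ (proj₂ sub) x x∉S x≢f) (<⇒≱ (<-≤-trans u<m m≤x))

          -- The witness is g = m and n = F(S) + 1 − m, so that g + n = F(S) + 1.
          sub<multiplicity⇒AlmostOrdinary : 2 < m → m < f → AlmostOrdinary S
          sub<multiplicity⇒AlmostOrdinary 2<m m<f =
            m , suc f ∸ m , 2<m ,
            subst (_≤ suc f ∸ m) (m+n∸n≡m 2 m) (∸-monoˡ-≤ m (s≤s m<f)) ,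
            m≤n+o⇒m∸n≤o (suc f) m sub<multiplicity⇒Frobenius<2m ,
            λ x → subst (λ c → Mem S x ⇔ (x ≡ 0 ⊎ (m ≤ x × x ≤ c ∸ 2) ⊎ c ≤ x))
                        (sym (m+[n∸m]≡n (≤-trans (<⇒≤ m<f) (n≤1+n f))))
                        (mk⇔ to from)
            where
            0<f : 0 < f
            0<f = <-trans (proj₁ (proj₂ mult)) m<f
            to : ∀ {x} → Mem S x → x ≡ 0 ⊎ (m ≤ x × x ≤ f ∸ 1) ⊎ suc f ≤ x
            to {x} x∈S with ∈⇒≡0⊎multiplicity≤ mult x∈S | <-cmp x f
            ... | inj₁ x≡0 | _           = inj₁ x≡0
            ... | inj₂ m≤x | tri< x<f _ _ = inj₂ (inj₁ (m≤x , ∸-monoˡ-≤ 1 x<f))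
            ... | inj₂ _   | tri≈ _ x≡f _ = contradiction (subst (Mem S) x≡f x∈S) (proj₁ frob)
            ... | inj₂ _   | tri> _ _ f<x = inj₂ (inj₂ f<x)
            from : ∀ {x} → x ≡ 0 ⊎ (m ≤ x × x ≤ f ∸ 1) ⊎ suc f ≤ x → Mem S x
            from (inj₁ refl)              = zero-mem S
            from (inj₂ (inj₁ (m≤x , x≤))) = sub<multiplicity⇒∈ m≤x (<⇒≢ (≤-<-trans x≤ (∸-monoʳ-< z<s 0<f)))
            from (inj₂ (inj₂ f<x))        = >Frobenius⇒∈ f<x

module 𝓑 (S : NumericalSemigroup) {f u m : ℕ}
         (frob : IsFrobenius S f) (sub : IsSubFrobenius S f u) (mult : IsMultiplicity S m)
         (B : NumericalSemigroup) (B-mem : ∀ x → Mem B x ⇔ ((Mem S x ⊎ x ≡ u) × x ≢ m)) where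

  private
    u∉S : ¬ Mem S u
    u∉S = proj₁ sub
    m∈S : Mem S m
    m∈S = proj₁ mult
    0<m : 0 < m
    0<m = proj₁ (proj₂ mult)

  u∈B : Mem B u
  u∈B = Equivalence.from (B-mem u) (inj₂ refl , λ u≡m → u∉S (subst (Mem S) (sym u≡m) m∈S))

  decomposable-B⇒decomposable-S⊎u+ : ∀ {x} → Decomposable B x →
                                      Decomposable S x ⊎ ∃[ b ] (Mem B b × 0 < b × u + b ≡ x)
  decomposable-B⇒decomposable-S⊎u+ (a , b , a∈B , b∈B , 0<a , 0<b , a+b≡x)
    with Equivalence.to (B-mem a) a∈B | Equivalence.to (B-mem b) b∈B
  ... | inj₁ a∈S , _ | inj₁ b∈S , _ = inj₁ (a , b , a∈S , b∈S , 0<a , 0<b , a+b≡x)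
  ... | inj₂ refl , _ | _           = inj₂ (b , b∈B , 0<b , a+b≡x)
  ... | _ | inj₂ refl , _           = inj₂ (a , a∈B , 0<a , trans (+-comm u a) a+b≡x)

  sub<multiplicity⇒2<multiplicity : u < m → 2 < m
  sub<multiplicity⇒2<multiplicity u<m with m ≤? 2
  ... | no  m≰2 = ≰⇒> m≰2
  ... | yes m≤2 = contradiction u+u≡m (proj₂ (Equivalence.to (B-mem (u + u)) (+-closed B u∈B u∈B)))
    where
    -- 0 < u < m ≤ 2 forces u = 1 and m = 2.
    u≡1 : u ≡ 1
    u≡1 = ≤-antisym (s≤s⁻¹ (≤-trans u<m m≤2)) (∉⇒positive S u∉S)
    u+u≡m : u + u ≡ m
    u+u≡m = trans (cong (λ v → v + v) u≡1) (≤-antisym (≤-trans (s≤s (∉⇒positive S u∉S)) u<m) m≤2)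

  multiplicity<sub : ¬ Ordinary S → ¬ AlmostOrdinary S → m < u
  multiplicity<sub ¬ord ¬almost with <-cmp m u | <-cmp f m
  ... | tri< m<u _ _ | _            = m<u
  ... | tri≈ _ m≡u _ | _            = contradiction (subst (Mem S) m≡u m∈S) u∉S
  ... | tri> _ _ u<m | tri< f<m _ _ = contradiction (Frobenius<multiplicity⇒Ordinary S frob mult f<m) ¬ord
  ... | tri> _ _ u<m | tri≈ _ f≡m _ = contradiction (subst (Mem S) (sym f≡m) m∈S) (proj₁ frob)
  ... | tri> _ _ u<m | tri> _ _ m<f = contradiction
          (sub<multiplicity⇒AlmostOrdinary S frob mult sub u<m (sub<multiplicity⇒2<multiplicity u<m) m<f) ¬almost

  module Generators (m<u : m < u) where

    positive∈B⇒multiplicity< : ∀ {x} → Mem B x → 0 < x → m < x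
    positive∈B⇒multiplicity< {x} x∈B 0<x with Equivalence.to (B-mem x) x∈B
    ... | inj₁ x∈S , x≢m = ≤∧≢⇒< (proj₂ (proj₂ mult) x x∈S 0<x) (x≢m ∘ sym)
    ... | inj₂ refl , _  = m<u

    -- u + b = m + (u + (b − m)), and u + (b − m) > u is a gap only if it is F(S).
    u+positive∈B-decomposable : ∀ {b} → Mem B b → 0 < b → u + b ≢ f + m → Decomposable S (u + b)
    u+positive∈B-decomposable {b} b∈B 0<b u+b≢f+m =
      m , u + (b ∸ m) , m∈S , y∈S , 0<m , <-≤-trans (∉⇒positive S u∉S) (m≤m+n u (b ∸ m)) , m+y≡u+b
      where
      m<b : m < b
      m<b = positive∈B⇒multiplicity< b∈B 0<b
      open ≡-Reasoning
      m+y≡u+b : m + (u + (b ∸ m)) ≡ u + b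
      m+y≡u+b = begin
        m + (u + (b ∸ m)) ≡⟨ x∙yz≈y∙xz m u (b ∸ m) ⟩
        u + (m + (b ∸ m)) ≡⟨ cong (u +_) (m+[n∸m]≡n (<⇒≤ m<b)) ⟩
        u + b             ∎
      y∈S : Mem S (u + (b ∸ m))
      y∈S with mem? S (u + (b ∸ m))
      ... | yes y∈S = y∈S
      ... | no  y∉S = contradiction (begin
              u + b             ≡⟨ m+y≡u+b ⟨
              m + (u + (b ∸ m)) ≡⟨ cong (m +_) (sub<gap⇒≡Frobenius S frob sub y∉S (m<m+n u (m<n⇒0<n∸m m<b))) ⟩
              m + f             ≡⟨ +-comm m f ⟩
              f + m             ∎) u+b≢f+m

    sub-minimal-in-B : MinimalGenerator B u
    sub-minimal-in-B = u∈B , ∉⇒positive S u∉S ,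
      [ (λ (a , b , a∈S , b∈S , _ , _ , a+b≡u) → u∉S (subst (Mem S) a+b≡u (+-closed S a∈S b∈S)))
      , (λ (b , _ , 0<b , u+b≡u) → <⇒≢ (m<m+n u 0<b) (sym u+b≡u)) ]
      ∘ decomposable-B⇒decomposable-S⊎u+

    double-multiplicity-minimal-in-B : MinimalGenerator B (m + m)
    double-multiplicity-minimal-in-B =
      Equivalence.from (B-mem (m + m)) (inj₁ (+-closed S m∈S m∈S) , <⇒≢ (m<m+n m 0<m) ∘ sym) ,
      <-≤-trans 0<m (m≤m+n m m) ,
      λ (a , b , a∈B , b∈B , 0<a , 0<b , a+b≡2m) →
        <⇒≢ (+-mono-< (positive∈B⇒multiplicity< a∈B 0<a) (positive∈B⇒multiplicity< b∈B 0<b)) (sym a+b≡2m)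

    minimal-in-S⇒minimal-in-B : ∀ {x} → MinimalGenerator S x → x ≢ m → x ≢ f + m → MinimalGenerator B x
    minimal-in-S⇒minimal-in-B {x} (x∈S , 0<x , x-indecomposable) x≢m x≢f+m =
      Equivalence.from (B-mem x) (inj₁ x∈S , x≢m) , 0<x ,
      [ x-indecomposable
      , (λ (b , b∈B , 0<b , u+b≡x) → x-indecomposable (subst (Decomposable S) u+b≡x
          (u+positive∈B-decomposable b∈B 0<b (x≢f+m ∘ trans (sym u+b≡x))))) ]
      ∘ decomposable-B⇒decomposable-S⊎u+

    toB : ℕ → ℕ
    toB x with x ≟ m | x ≟ f + m
    ... | yes _ | _     = u
    ... | no  _ | yes _ = m + m
    ... | no  _ | no  _ = x

    fromB : ℕ → ℕ
    fromB y with y ≟ u | y ≟ m + m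
    ... | yes _ | _     = m
    ... | no  _ | yes _ = f + m
    ... | no  _ | no  _ = y

    toB-minimal : ∀ {x} → MinimalGenerator S x → MinimalGenerator B (toB x)
    toB-minimal {x} x-minimal with x ≟ m | x ≟ f + m
    ... | yes _   | _         = sub-minimal-in-B
    ... | no  _   | yes _     = double-multiplicity-minimal-in-B
    ... | no  x≢m | no  x≢f+m = minimal-in-S⇒minimal-in-B x-minimal x≢m x≢f+m

    -- u is a gap and m + m is decomposable, so neither is a minimal generator of S.
    fromB-toB : ∀ {x} → MinimalGenerator S x → fromB (toB x) ≡ x
    fromB-toB {x} (x∈S , _ , x-indecomposable) with x ≟ m | x ≟ f + m
    ... | yes x≡m | _ rewrite ≟-diag (refl {x = u}) = sym x≡m
    ... | no  _   | yes x≡f+m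
      rewrite dec-no (m + m ≟ u) (λ 2m≡u → u∉S (subst (Mem S) 2m≡u (+-closed S m∈S m∈S)))
            | ≟-diag (refl {x = m + m}) = sym x≡f+m
    ... | no  _   | no  _
      rewrite dec-no (x ≟ u) (λ x≡u → u∉S (subst (Mem S) x≡u x∈S))
            | dec-no (x ≟ m + m) (λ x≡2m → x-indecomposable (m , m , m∈S , m∈S , 0<m , 0<m , sym x≡2m)) = refl

    toB-injective : ∀ {x y} → MinimalGenerator S x → MinimalGenerator S y → toB x ≡ toB y → x ≡ y
    toB-injective {x} {y} x-minimal y-minimal toBx≡toBy = begin
      x             ≡⟨ fromB-toB x-minimal ⟨
      fromB (toB x) ≡⟨ cong fromB toBx≡toBy ⟩
      fromB (toB y) ≡⟨ fromB-toB y-minimal ⟩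
      y             ∎
      where open ≡-Reasoning

proposition6p7 : (S : NumericalSemigroup) → ¬ Ordinary S → ¬ AlmostOrdinary S →
    (f u m : ℕ) → IsFrobenius S f → IsSubFrobenius S f u → IsMultiplicity S m →
    (B : NumericalSemigroup) → (∀ x → Mem B x ⇔ ((Mem S x ⊎ x ≡ u) × x ≢ m)) →
    (k l : ℕ) → EmbeddingDimension S k → EmbeddingDimension B l → k ≤ l
proposition6p7 S ¬ord ¬almost f u m frob sub mult B B-mem _ _
               (gensS , gensS-unique , ∈gensS , refl) (_ , _ , ∈gensB , refl) =
  length-≤-by-injection toB gensS-unique
    (λ x∈gensS y∈gensS → toB-injective (minimal x∈gensS) (minimal y∈gensS))
    (λ x∈gensS → Equivalence.from (∈gensB _) (toB-minimal (minimal x∈gensS)))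
  where
  open 𝓑 S frob sub mult B B-mem
  open Generators (multiplicity<sub ¬ord ¬almost)
  minimal : ∀ {x} → x ∈ gensS → MinimalGenerator S x
  minimal = Equivalence.to (∈gensS _)
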